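{- Let $\mathbb{F}_q$ be a finite field of odd characteristic $p$, let $a\in\mathbb{F}_q$ and $Q=\begin{pmatrix} a & 1\\ 1 & 0\end{pmatrix}$. If the characteristic polynomial $x^2-ax-1$ has a repeated root in $\mathbb{F}_q$, then $q\equiv 1\pmod 4$, and in this case the non-trivial orbits of $G=\langle Q\rangle$ acting on $\mathbb{F}_q\times\mathbb{F}_q$ have lengths $4$ and $4p$.
   Context: $G=\langle Q\rangle$ acts on $\mathbb{F}_q\times\mathbb{F}_q$ (column vectors) by $v\mapsto Q^nv$; orbit length is the number of elements of the orbit; non-trivial orbits are orbits of non-zero vectors. -}

module Defs where

open import Level using (Level; suc; _⊔_) renaming (zero to lzero)
open import Data.Nat as ℕ using (ℕ; _<_)
open import Data.Fin using (Fin)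
open import Data.Integer using (ℤ; +_; -[1+_])
open import Data.Product using (Σ; _×_; _,_; ∃; ∃-syntax)
open import Relation.Binary.PropositionalEquality using (_≡_)
open import Relation.Nullary using (¬_)
open import Algebra.Structures using (IsCommutativeRing)
open import Function.Bundles using (_↔_)
open import Function.Definitions using (Injective)

record FiniteField (q : ℕ) : Set₁ where
  infixl 7 _*_
  infixl 6 _+_
  field
    Carrier : Set
    _+_ _*_ : Carrier → Carrier → Carrier
    -_      : Carrier → Carrier
    0# 1#   : Carrier
    isCommutativeRing : IsCommutativeRing _≡_ _+_ _*_ -_ 0# 1#
    0≢1     : ¬ (0# ≡ 1#)
    inv     : (x : Carrier) → ¬ (x ≡ 0#) → Σ Carrier λ y → x * y ≡ 1#
    enum    : Carrier ↔ Fin q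

  _·1 : ℕ → Carrier
  ℕ.zero  ·1 = 0#
  ℕ.suc n ·1 = 1# + n ·1

  HasCharacteristic : ℕ → Set
  HasCharacteristic p = 0 < p × p ·1 ≡ 0# × (∀ n → 0 < n → n < p → ¬ (n ·1 ≡ 0#))

  V : Set
  V = Carrier × Carrier

  zeroV : V
  zeroV = 0# , 0#

  -- 2×2 matrices, stored row by row: ((m11 , m12) , (m21 , m22))
  M : Set
  M = V × V

  _·_ : M → V → V
  ((m11 , m12) , (m21 , m22)) · (x , y) = (m11 * x + m12 * y) , (m21 * x + m22 * y)

  Q : Carrier → M
  Q a = (a , 1#) , (1# , 0#)

  Qinv : Carrier → M
  Qinv a = (0# , 1#) , (1# , - a)

  iter : M → ℕ → V → V
  iter m ℕ.zero    v = v
  iter m (ℕ.suc n) v = m · iter m n v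

  actQ : Carrier → ℤ → V → V
  actQ a (+ n)      v = iter (Q a) n v
  actQ a -[1+ n ]   v = iter (Qinv a) (ℕ.suc n) v

  InOrbit : Carrier → V → V → Set
  InOrbit a v w = ∃[ n ] w ≡ actQ a n v

  OrbitLength : Carrier → V → ℕ → Set
  OrbitLength a v L =
    Σ (Fin L → V) λ f → Injective _≡_ _≡_ f × (∀ w → InOrbit a v w → ∃[ i ] f i ≡ w)
                                             × (∀ i → InOrbit a v (f i))

  -- x² - a x - 1 has a repeated root r in F_q: x² - a x - 1 = (x - r)²,
  -- i.e. (comparing coefficients) r + r = a and r * r = - 1
  HasRepeatedRoot : Carrier → Set
  HasRepeatedRoot a = ∃[ r ] (r + r ≡ a × r * r ≡ - 1#)

module Submission where

-- A repeated root r of x² - a x - 1 satisfies a = 2r and r² = -1. As 2 ≠ 0 in odd characteristic,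
-- r has multiplicative order 4, and multiplication by r splits the nonzero elements of F_q into
-- 4-cycles, so q ≡ 1 (mod 4). Since Q - r is nilpotent, Qⁿ v = rⁿ v + n rⁿ⁻¹ κ(v) (1 , -r) with
-- κ(x , y) = r x + y. Hence Qᵈ v = v iff 4 ∣ d when v is an eigenvector (κ v = 0), and otherwise
-- iff 4 ∣ d and p ∣ d, i.e. (4 being invertible) 4p ∣ d; the orbit of v is then listed by Qⁱ v
-- for i below the period 4 resp. 4p.

open import Defs
open import Algebra.Bundles using (CommutativeRing)
import Algebra.Properties.Group as GroupProperties
import Algebra.Properties.Semiring.Exp as SemiringExp
import Algebra.Properties.Semiring.Mult as SemiringMult
import Data.Integer as ℤ
open import Data.Fin using (Fin; toℕ; fromℕ<)
open import Data.Fin.Properties using (inj⇒≟; toℕ-injective; toℕ<n; toℕ-fromℕ<)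
open import Data.List using (List; []; _∷_; map; length; filter; foldr; allFin)
open import Data.List.Membership.Propositional using (_∈_; _∉_)
open import Data.List.Membership.Propositional.Properties using (∈-filter⁺; ∈-filter⁻; ∈-map⁺; ∈-allFin)
open import Data.List.Properties using (filter-accept; filter-reject; filter-all; length-map; length-tabulate)
open import Data.List.Relation.Unary.All as All using (All; []; _∷_)
open import Data.List.Relation.Unary.AllPairs using ([]; _∷_)
open import Data.List.Relation.Unary.Any using (here; there)
open import Data.List.Relation.Unary.Unique.Propositional using (Unique)
open import Data.List.Relation.Unary.Unique.Propositional.Properties using (filter⁺; map⁺; allFin⁺)
open import Data.Nat as ℕ using (ℕ; zero; suc; _<_; s≤s; z≤n)
open import Data.Nat.DivMod using (_%_; _/_; m≡m%n+[m/n]*n; m%n<n; [m+kn]%n≡m%n)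
open import Data.Nat.Divisibility
  using (_∣_; divides; _∣0; m%n≡0⇒n∣m; ∣-refl; ∣-trans; ∣⇒≤; ∣m∣n⇒∣m+n; m∣m*n; n∣m*n; *-monoʳ-∣)
open import Data.Nat.Induction using (<-wellFounded)
import Data.Nat.Properties as ℕ
open import Data.Product using (_×_; _,_; proj₁; proj₂; ∃-syntax)
open import Data.Sum using (_⊎_; inj₁; inj₂)
open import Function using (_∘_)
open import Function.Bundles using (_⇔_; Equivalence; mk⇔; Inverse)
open import Function.Properties.Equivalence using () renaming (trans to ⇔-trans)
open import Function.Properties.Inverse using (↔⇒↣)
open import Induction.WellFounded using (Acc; acc)
open import Relation.Binary.Definitions using (DecidableEquality; tri<; tri≈; tri>)
open import Relation.Binary.PropositionalEquality
open import Relation.Nullary using (¬_; ¬?; yes; no; contradiction)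

module ListDifference {a} {A : Set a} (_≟_ : DecidableEquality A) where

  remove : A → List A → List A
  remove x = filter (λ y → ¬? (y ≟ x))

  length-remove : ∀ {x xs} → Unique xs → x ∈ xs → suc (length (remove x xs)) ≡ length xs
  length-remove {x} {_ ∷ xs} (x∉xs ∷ _) (here refl) = cong (suc ∘ length) (begin
    remove x (x ∷ xs) ≡⟨ filter-reject (λ y → ¬? (y ≟ x)) (λ x≢x → x≢x refl) ⟩
    remove x xs       ≡⟨ filter-all (λ y → ¬? (y ≟ x)) (All.map (λ x≢y y≡x → x≢y (sym y≡x)) x∉xs) ⟩
    xs                ∎)
    where open ≡-Reasoning
  length-remove {x} {y ∷ xs} (y∉xs ∷ u) (there x∈xs) = begin
    suc (length (remove x (y ∷ xs))) ≡⟨ cong (suc ∘ length) (filter-accept (λ z → ¬? (z ≟ x)) y≢x) ⟩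
    suc (suc (length (remove x xs))) ≡⟨ cong suc (length-remove u x∈xs) ⟩
    length (y ∷ xs)                  ∎
    where
    open ≡-Reasoning
    y≢x : ¬ y ≡ x
    y≢x = All.lookup y∉xs x∈xs

  infixl 5 _∖_
  _∖_ : List A → List A → List A
  xs ∖ ys = foldr remove xs ys

  ∈-∖⁻ : ∀ {z} xs ys → z ∈ xs ∖ ys → z ∈ xs × z ∉ ys
  ∈-∖⁻ xs []       z∈ = z∈ , λ ()
  ∈-∖⁻ xs (y ∷ ys) z∈ with ∈-filter⁻ (λ w → ¬? (w ≟ y)) z∈
  ... | z∈′ , z≢y with ∈-∖⁻ xs ys z∈′
  ...   | z∈xs , z∉ys = z∈xs , λ { (here z≡y) → z≢y z≡y ; (there z∈ys) → z∉ys z∈ys }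

  ∈-∖⁺ : ∀ {z} xs ys → z ∈ xs → z ∉ ys → z ∈ xs ∖ ys
  ∈-∖⁺ xs []       z∈xs z∉ys = z∈xs
  ∈-∖⁺ xs (y ∷ ys) z∈xs z∉ys =
    ∈-filter⁺ (λ w → ¬? (w ≟ y)) (∈-∖⁺ xs ys z∈xs (z∉ys ∘ there)) (z∉ys ∘ here)

  ∖-unique : ∀ {xs} ys → Unique xs → Unique (xs ∖ ys)
  ∖-unique []       u = u
  ∖-unique (y ∷ ys) u = filter⁺ (λ w → ¬? (w ≟ y)) (∖-unique ys u)

  length-∖ : ∀ {xs ys} → Unique xs → Unique ys → All (_∈ xs) ys →
             length ys ℕ.+ length (xs ∖ ys) ≡ length xs
  length-∖             u []            []          = refl
  length-∖ {xs} {y ∷ ys} u (y∉ys ∷ uys) (y∈xs ∷ ys⊆xs) = begin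
    suc (length ys ℕ.+ length (remove y (xs ∖ ys))) ≡⟨ sym (ℕ.+-suc _ _) ⟩
    length ys ℕ.+ suc (length (remove y (xs ∖ ys))) ≡⟨ cong (length ys ℕ.+_) (length-remove (∖-unique ys u) y∈xs∖ys) ⟩
    length ys ℕ.+ length (xs ∖ ys)                  ≡⟨ length-∖ u uys ys⊆xs ⟩
    length xs                                       ∎
    where
    open ≡-Reasoning
    y∈xs∖ys : y ∈ xs ∖ ys
    y∈xs∖ys = ∈-∖⁺ xs ys y∈xs (λ y∈ys → All.lookup y∉ys y∈ys refl)

  module _ (σ : A → A) (σ⁴≡id : ∀ x → σ (σ (σ (σ x))) ≡ x) where

    orbit : A → List A
    orbit x = x ∷ σ x ∷ σ (σ x) ∷ σ (σ (σ x)) ∷ []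

    σ-injective : ∀ {x y} → σ x ≡ σ y → x ≡ y
    σ-injective {x} {y} σx≡σy = trans (sym (σ⁴≡id x)) (trans (cong (σ ∘ σ ∘ σ) σx≡σy) (σ⁴≡id y))

    orbit-unique : ∀ {x} → ¬ σ (σ x) ≡ x → Unique (orbit x)
    orbit-unique {x} σ²x≢x =
        (σ¹≢ ∷ σ²≢ ∷ σ³≢ ∷ []) ∷ (σ¹≢ ∘ σ-injective ∷ σ²≢ ∘ σ-injective ∷ [])
      ∷ (σ¹≢ ∘ σ-injective ∘ σ-injective ∷ []) ∷ [] ∷ []
      where
      σ¹≢ : ¬ x ≡ σ x
      σ¹≢ x≡σx = σ²x≢x (trans (cong σ (sym x≡σx)) (sym x≡σx))
      σ²≢ : ¬ x ≡ σ (σ x)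
      σ²≢ = σ²x≢x ∘ sym
      σ³≢ : ¬ x ≡ σ (σ (σ x))
      σ³≢ x≡σ³x = σ¹≢ (trans (sym (σ⁴≡id x)) (cong σ (sym x≡σ³x)))

    ∈-orbit-σ : ∀ {x z} → z ∈ orbit x → σ z ∈ orbit x
    ∈-orbit-σ (here refl)                         = there (here refl)
    ∈-orbit-σ (there (here refl))                 = there (there (here refl))
    ∈-orbit-σ (there (there (here refl)))         = there (there (there (here refl)))
    ∈-orbit-σ {x} (there (there (there (here refl)))) = here (σ⁴≡id x)

    ∈-orbit-σ⁻ : ∀ {x z} → σ z ∈ orbit x → z ∈ orbit x
    ∈-orbit-σ⁻ {z = z} σz∈ = subst (_∈ _) (σ⁴≡id z) (∈-orbit-σ (∈-orbit-σ (∈-orbit-σ σz∈)))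

    4∣length : ∀ xs → Unique xs → (∀ {x} → x ∈ xs → σ x ∈ xs) → (∀ {x} → x ∈ xs → ¬ σ (σ x) ≡ x) →
               4 ∣ length xs
    4∣length xs = go xs (<-wellFounded (length xs))
      where
      go : ∀ xs → Acc _<_ (length xs) → Unique xs → (∀ {x} → x ∈ xs → σ x ∈ xs) →
           (∀ {x} → x ∈ xs → ¬ σ (σ x) ≡ x) → 4 ∣ length xs
      go []       _        _ _      _    = 4 ∣0
      go (x ∷ xs) (acc rs) u closed free = subst (4 ∣_) length≡ (∣m∣n⇒∣m+n ∣-refl (go ys (rs ys<) uys ys-closed ys-free))
        where
        xs′ = x ∷ xs
        x∈ : x ∈ xs′
        x∈ = here refl
        ys = xs′ ∖ orbit x
        orbit⊆ : All (_∈ xs′) (orbit x)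
        orbit⊆ = x∈ ∷ closed x∈ ∷ closed (closed x∈) ∷ closed (closed (closed x∈)) ∷ []
        length≡ : 4 ℕ.+ length ys ≡ length xs′
        length≡ = length-∖ u (orbit-unique (free x∈)) orbit⊆
        ys< : length ys < length xs′
        ys< = subst (length ys <_) length≡ (ℕ.m≤n+m (suc (length ys)) 3)
        uys : Unique ys
        uys = ∖-unique (orbit x) u
        ys-closed : ∀ {z} → z ∈ ys → σ z ∈ ys
        ys-closed {z} z∈ with ∈-∖⁻ xs′ (orbit x) z∈
        ... | z∈xs , z∉orbit = ∈-∖⁺ xs′ (orbit x) (closed z∈xs) (z∉orbit ∘ ∈-orbit-σ⁻)
        ys-free : ∀ {z} → z ∈ ys → ¬ σ (σ z) ≡ z
        ys-free z∈ = free (proj₁ (∈-∖⁻ xs′ (orbit x) z∈))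

module _ {q : ℕ} (F : FiniteField q) where
  open FiniteField F

  commutativeRing : CommutativeRing _ _
  commutativeRing = record { isCommutativeRing = isCommutativeRing }

  open CommutativeRing commutativeRing
    using (-‿inverseˡ; -‿inverseʳ; +-identityˡ; +-identityʳ; *-identityˡ; *-identityʳ; *-comm; zeroˡ; zeroʳ; commutativeSemiring; semiring; +-group)
  open SemiringMult semiring using (×-homo-+; ×1-homo-*) renaming (_×_ to _×ₙ_)
  open SemiringExp semiring using (_^_; ^-homo-*)
  open import Algebra.Solver.Ring.NaturalCoefficients.Default commutativeSemiring

  _≟_ : DecidableEquality Carrier
  _≟_ = inj⇒≟ (↔⇒↣ enum)

  elements : List Carrier
  elements = map (Inverse.from enum) (allFin q)

  ∈-elements : ∀ z → z ∈ elements
  ∈-elements z = subst (_∈ elements) (strictlyInverseʳ z) (∈-map⁺ from (∈-allFin (to z)))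
    where open Inverse enum

  elements-unique : Unique elements
  elements-unique = map⁺ from-injective (allFin⁺ q)
    where
    open Inverse enum
    from-injective : ∀ {i j} → from i ≡ from j → i ≡ j
    from-injective {i} {j} eq = trans (sym (strictlyInverseˡ i)) (trans (cong to eq) (strictlyInverseˡ j))

  length-elements : length elements ≡ q
  length-elements = trans (length-map _ (allFin q)) (length-tabulate (λ i → i))

  *-cancelˡ : ∀ {x y z} → ¬ x ≡ 0# → x * y ≡ x * z → y ≡ z
  *-cancelˡ {x} {y} {z} x≢0 xy≡xz with inv x x≢0
  ... | x⁻¹ , xx⁻¹≡1 = begin
    y               ≡⟨ unit y ⟩
    x⁻¹ * (x * y)   ≡⟨ cong (x⁻¹ *_) xy≡xz ⟩
    x⁻¹ * (x * z)   ≡⟨ sym (unit z) ⟩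
    z               ∎
    where
    open ≡-Reasoning
    unit : ∀ w → w ≡ x⁻¹ * (x * w)
    unit w = begin
      w               ≡⟨ sym (*-identityˡ w) ⟩
      1# * w          ≡⟨ cong (_* w) (sym xx⁻¹≡1) ⟩
      x * x⁻¹ * w     ≡⟨ solve 3 (λ x x⁻¹ w → x :* x⁻¹ :* w := x⁻¹ :* (x :* w)) refl x x⁻¹ w ⟩
      x⁻¹ * (x * w)   ∎

  *-cancelʳ-≡1 : ∀ {c x} → ¬ x ≡ 0# → c * x ≡ x → c ≡ 1#
  *-cancelʳ-≡1 {c} {x} x≢0 cx≡x = *-cancelˡ x≢0 (trans (*-comm x c) (trans cx≡x (sym (*-identityʳ x))))

  zero-product : ∀ {x y} → x * y ≡ 0# → ¬ x ≡ 0# → y ≡ 0#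
  zero-product {x} xy≡0 x≢0 = *-cancelˡ x≢0 (trans xy≡0 (sym (zeroʳ x)))

  +-cancelˡ-≡0 : ∀ {x y} → x + y ≡ x → y ≡ 0#
  +-cancelˡ-≡0 = GroupProperties.identityʳ-unique +-group _ _

  -- The semiring solver proves identities modulo a vanishing z (such as r² + 1) in this
  -- subtraction-free form.
  ≡-modulo : ∀ {x y z k l} → z ≡ 0# → x + z * k ≡ y + z * l → x ≡ y
  ≡-modulo {x} {y} {z} {k} {l} refl eq = begin
    x            ≡⟨ sym (vanish x k) ⟩
    x + 0# * k   ≡⟨ eq ⟩
    y + 0# * l   ≡⟨ vanish y l ⟩
    y            ∎
    where
    open ≡-Reasoning
    vanish : ∀ w m → w + 0# * m ≡ w
    vanish w m = trans (cong (w +_) (zeroˡ m)) (+-identityʳ w)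

  ·1≡×1 : ∀ n → n ·1 ≡ n ×ₙ 1#
  ·1≡×1 zero    = refl
  ·1≡×1 (suc n) = cong (1# +_) (·1≡×1 n)

  ·1-homo-+ : ∀ m n → (m ℕ.+ n) ·1 ≡ m ·1 + n ·1
  ·1-homo-+ m n rewrite ·1≡×1 (m ℕ.+ n) | ·1≡×1 m | ·1≡×1 n = ×-homo-+ 1# m n

  ·1-homo-* : ∀ m n → (m ℕ.* n) ·1 ≡ m ·1 * n ·1
  ·1-homo-* m n rewrite ·1≡×1 (m ℕ.* n) | ·1≡×1 m | ·1≡×1 n = ×1-homo-* m n

  -- Orbits of the cyclic group ⟨Q⟩

  iter-+ : ∀ A m n v → iter A (m ℕ.+ n) v ≡ iter A m (iter A n v)
  iter-+ A zero    n v = refl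
  iter-+ A (suc m) n v = cong (A ·_) (iter-+ A m n v)

  iter-*-period : ∀ {A L v} → iter A L v ≡ v → ∀ k → iter A (k ℕ.* L) v ≡ v
  iter-*-period         returns zero    = refl
  iter-*-period {A} {L} {v} returns (suc k) =
    trans (iter-+ A L _ v) (trans (cong (iter A L) (iter-*-period returns k)) returns)

  iter-% : ∀ {A L v} .{{_ : ℕ.NonZero L}} → iter A L v ≡ v → ∀ n → iter A n v ≡ iter A (n % L) v
  iter-% {A} {L} {v} returns n = begin
    iter A n v                                   ≡⟨ cong (λ m → iter A m v) (m≡m%n+[m/n]*n n L) ⟩
    iter A (n % L ℕ.+ (n / L) ℕ.* L) v           ≡⟨ iter-+ A (n % L) _ v ⟩
    iter A (n % L) (iter A ((n / L) ℕ.* L) v)    ≡⟨ cong (iter A (n % L)) (iter-*-period returns (n / L)) ⟩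
    iter A (n % L) v                             ∎
    where open ≡-Reasoning

  Qinv-Q : ∀ a w → Qinv a · (Q a · w) ≡ w
  Qinv-Q a (x , y) = cong₂ _,_
    (solve 3 (λ a x y → con 0 :* (a :* x :+ con 1 :* y) :+ con 1 :* (con 1 :* x :+ con 0 :* y) := x) refl a x y)
    (≡-modulo (-‿inverseʳ a) (solve 4 (λ a -a x y →
        con 1 :* (a :* x :+ con 1 :* y) :+ -a :* (con 1 :* x :+ con 0 :* y) :+ (a :+ -a) :* con 0
      := y :+ (a :+ -a) :* x) refl a (- a) x y))

  iter-Q-injective : ∀ a n {w w′} → iter (Q a) n w ≡ iter (Q a) n w′ → w ≡ w′
  iter-Q-injective a zero    eq = eq
  iter-Q-injective a (suc n) eq =
    iter-Q-injective a n (trans (sym (Qinv-Q a _)) (trans (cong (Qinv a ·_) eq) (Qinv-Q a _)))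

  orbitLength : ∀ {a v} L .{{_ : ℕ.NonZero L}} → (∀ d → iter (Q a) d v ≡ v ⇔ L ∣ d) → OrbitLength a v L
  orbitLength {a} {v} L@(suc L′) period = f , f-injective , f-surjective , λ i → ℤ.+ toℕ i , refl
    where
    open Equivalence
    open ≡-Reasoning

    f : Fin L → V
    f i = iter (Q a) (toℕ i) v

    returns : iter (Q a) L v ≡ v
    returns = from (period L) ∣-refl

    distinct : ∀ {i j} → i < j → j < L → ¬ iter (Q a) i v ≡ iter (Q a) j v
    distinct {i} {j} i<j j<L eq = ℕ.<⇒≱ (ℕ.≤-<-trans (ℕ.m∸n≤m j i) j<L) L≤j∸i
      where
      fixed : iter (Q a) (j ℕ.∸ i) v ≡ v
      fixed = sym (iter-Q-injective a i (begin
        iter (Q a) i v                            ≡⟨ eq ⟩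
        iter (Q a) j v                            ≡⟨ cong (λ m → iter (Q a) m v) (sym (ℕ.m+[n∸m]≡n (ℕ.<⇒≤ i<j))) ⟩
        iter (Q a) (i ℕ.+ (j ℕ.∸ i)) v            ≡⟨ iter-+ (Q a) i _ v ⟩
        iter (Q a) i (iter (Q a) (j ℕ.∸ i) v)     ∎))
      L≤j∸i : L ℕ.≤ j ℕ.∸ i
      L≤j∸i = ∣⇒≤ {{ℕ.>-nonZero (ℕ.m<n⇒0<n∸m i<j)}} (to (period (j ℕ.∸ i)) fixed)

    f-injective : ∀ {i j} → f i ≡ f j → i ≡ j
    f-injective {i} {j} eq with ℕ.<-cmp (toℕ i) (toℕ j)
    ... | tri< i<j _ _ = contradiction eq (distinct i<j (toℕ<n j))
    ... | tri≈ _ i≡j _ = toℕ-injective i≡j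
    ... | tri> _ _ j<i = contradiction (sym eq) (distinct j<i (toℕ<n i))

    reached : ∀ n → f (fromℕ< (m%n<n n L)) ≡ iter (Q a) n v
    reached n = trans (cong (λ m → iter (Q a) m v) (toℕ-fromℕ< (m%n<n n L))) (sym (iter-% returns n))

    backwards : ∀ m → ∃[ k ] iter (Qinv a) m v ≡ iter (Q a) k v
    backwards zero    = 0 , refl
    backwards (suc m) with backwards m
    ... | k , eq = L′ ℕ.+ k , (begin
      Qinv a · iter (Qinv a) m v                    ≡⟨ cong (Qinv a ·_) eq ⟩
      Qinv a · iter (Q a) k v                       ≡⟨ cong (λ w → Qinv a · iter (Q a) k w) (sym returns) ⟩
      Qinv a · iter (Q a) k (iter (Q a) L v)        ≡⟨ cong (Qinv a ·_) (sym (iter-+ (Q a) k L v)) ⟩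
      Qinv a · iter (Q a) (k ℕ.+ L) v               ≡⟨ cong (λ m → Qinv a · iter (Q a) m v) (ℕ.+-comm k L) ⟩
      Qinv a · (Q a · iter (Q a) (L′ ℕ.+ k) v)      ≡⟨ Qinv-Q a _ ⟩
      iter (Q a) (L′ ℕ.+ k) v                       ∎)

    f-surjective : ∀ w → InOrbit a v w → ∃[ i ] f i ≡ w
    f-surjective w (ℤ.+ n , w≡) = _ , trans (reached n) (sym w≡)
    f-surjective w (ℤ.-[1+ n ] , w≡) with backwards (suc n)
    ... | k , eq = _ , trans (reached k) (sym (trans w≡ eq))

  -- The characteristic

  module _ {p : ℕ} (char : HasCharacteristic p) where

    ∣⇒·1≡0 : ∀ {n} → p ∣ n → n ·1 ≡ 0#
    ∣⇒·1≡0 (divides k refl) = trans (·1-homo-* k p) (trans (cong (k ·1 *_) (proj₁ (proj₂ char))) (zeroʳ _))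

    instance
      p≢0 : ℕ.NonZero p
      p≢0 = ℕ.>-nonZero (proj₁ char)

    ·1≡0⇒∣ : ∀ {n} → n ·1 ≡ 0# → p ∣ n
    ·1≡0⇒∣ {n} n·1≡0 = m%n≡0⇒n∣m n p (below-char (n % p) (m%n<n n p) remainder·1≡0)
      where
      below-char : ∀ m → m < p → m ·1 ≡ 0# → m ≡ 0
      below-char zero    _   _     = refl
      below-char (suc m) m<p m·1≡0 = contradiction m·1≡0 (proj₂ (proj₂ char) (suc m) (s≤s z≤n) m<p)
      remainder·1≡0 : (n % p) ·1 ≡ 0#
      remainder·1≡0 = begin
        (n % p) ·1                            ≡⟨ sym (+-identityʳ _) ⟩
        (n % p) ·1 + 0#                       ≡⟨ cong ((n % p) ·1 +_) (sym (∣⇒·1≡0 (divides (n / p) refl))) ⟩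
        (n % p) ·1 + ((n / p) ℕ.* p) ·1       ≡⟨ sym (·1-homo-+ (n % p) _) ⟩
        (n % p ℕ.+ (n / p) ℕ.* p) ·1          ≡⟨ cong _·1 (sym (m≡m%n+[m/n]*n n p)) ⟩
        n ·1                                  ≡⟨ n·1≡0 ⟩
        0#                                    ∎
        where open ≡-Reasoning

    odd⇒2·1≢0 : p % 2 ≡ 1 → ¬ 2 ·1 ≡ 0#
    odd⇒2·1≢0 p-odd 2·1≡0 = 0≢1 (sym (trans (sym (+-identityʳ 1#)) 1·1≡0))
      where
      odd-divisor-of-2 : ∀ {m} → m ∣ 2 → m % 2 ≡ 1 → m ≡ 1
      odd-divisor-of-2 m∣2 m-odd with ∣⇒≤ m∣2
      ... | s≤s z≤n = refl
      odd-divisor-of-2 {zero}  _ () | z≤n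
      odd-divisor-of-2 {2}     _ () | s≤s (s≤s z≤n)
      1·1≡0 : 1 ·1 ≡ 0#
      1·1≡0 = subst (λ m → m ·1 ≡ 0#) (odd-divisor-of-2 (·1≡0⇒∣ 2·1≡0) p-odd) (proj₁ (proj₂ char))

    module RepeatedRoot (p-odd : p % 2 ≡ 1) (r : Carrier) (r²≡-1 : r * r ≡ - 1#) where

      r²+1≡0 : r * r + 1# ≡ 0#
      r²+1≡0 = trans (cong (_+ 1#) r²≡-1) (-‿inverseˡ 1#)

      κ : V → Carrier
      κ (x , y) = r * x + y

      κ[0,y]≡y : ∀ y → κ (0# , y) ≡ y
      κ[0,y]≡y y = trans (cong (_+ y) (zeroʳ r)) (+-identityˡ y)

      -- The closed form of the header, with -1 = r² and r⁻¹ = r³ to avoid subtraction.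

      iter-Q : ∀ n x y → iter (Q (r + r)) n (x , y)
             ≡ (r ^ n * (x + n ·1 * (r * r * r * κ (x , y))) , r ^ n * (y + n ·1 * (r * r * κ (x , y))))
      iter-Q zero    x y = cong₂ _,_
        (solve 3 (λ r x y → x := con 1 :* (x :+ con 0 :* (r :* r :* r :* (r :* x :+ y)))) refl r x y)
        (solve 3 (λ r x y → y := con 1 :* (y :+ con 0 :* (r :* r :* (r :* x :+ y)))) refl r x y)
      iter-Q (suc n) x y = trans (cong (Q (r + r) ·_) (iter-Q n x y)) (cong₂ _,_
        (≡-modulo r²+1≡0 (solve 5 (λ r x y c P →
            (r :+ r) :* (P :* (x :+ c :* (r :* r :* r :* (r :* x :+ y)))) :+ con 1 :* (P :* (y :+ c :* (r :* r :* (r :* x :+ y))))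
              :+ (r :* r :+ con 1) :* (P :* (r :* r :* (r :* x :+ y)))
          := (r :* P) :* (x :+ (con 1 :+ c) :* (r :* r :* r :* (r :* x :+ y)))
              :+ (r :* r :+ con 1) :* (P :* (r :* x :+ y) :+ P :* c :* (r :* r :* (r :* x :+ y))))
          refl r x y (n ·1) (r ^ n)))
        (≡-modulo r²+1≡0 (solve 5 (λ r x y c P →
            con 1 :* (P :* (x :+ c :* (r :* r :* r :* (r :* x :+ y)))) :+ con 0 :* (P :* (y :+ c :* (r :* r :* (r :* x :+ y))))
              :+ (r :* r :+ con 1) :* (P :* (r :* r :* x :+ r :* y))
          := (r :* P) :* (y :+ (con 1 :+ c) :* (r :* r :* (r :* x :+ y)))
              :+ (r :* r :+ con 1) :* (P :* x))
          refl r x y (n ·1) (r ^ n))))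

      r*r≢0 : ¬ r * r ≡ 0#
      r*r≢0 r*r≡0 = 0≢1 (trans (sym r²+1≡0) (trans (cong (_+ 1#) r*r≡0) (+-identityˡ 1#)))

      r≢0 : ¬ r ≡ 0#
      r≢0 r≡0 = r*r≢0 (trans (cong (r *_) r≡0) (zeroʳ r))

      r²z≢z : ∀ {z} → ¬ z ≡ 0# → ¬ r * (r * z) ≡ z
      r²z≢z {z} z≢0 r²z≡z = z≢0 (zero-product 2z≡0 (odd⇒2·1≢0 p-odd))
        where
        open ≡-Reasoning
        2z≡0 : 2 ·1 * z ≡ 0#
        2z≡0 = begin
          2 ·1 * z              ≡⟨ solve 1 (λ z → (con 1 :+ (con 1 :+ con 0)) :* z := z :+ z) refl z ⟩
          z + z                 ≡⟨ cong (_+ z) (sym r²z≡z) ⟩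
          r * (r * z) + z       ≡⟨ solve 2 (λ r z → r :* (r :* z) :+ z := (r :* r :+ con 1) :* z) refl r z ⟩
          (r * r + 1#) * z      ≡⟨ cong (_* z) r²+1≡0 ⟩
          0# * z                ≡⟨ zeroˡ z ⟩
          0#                    ∎

      r^4≡1 : r ^ 4 ≡ 1#
      r^4≡1 = ≡-modulo r²+1≡0 (solve 1 (λ r →
        r :* (r :* (r :* (r :* con 1))) :+ (r :* r :+ con 1) :* con 1 := con 1 :+ (r :* r :+ con 1) :* (r :* r)) refl r)

      r^2≢1 : ¬ r ^ 2 ≡ 1#
      r^2≢1 = r²z≢z (λ 1≡0 → 0≢1 (sym 1≡0))

      r^1≢1 : ¬ r ^ 1 ≡ 1#
      r^1≢1 r≡1 = r^2≢1 (trans (cong (r *_) r≡1) r≡1)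

      r^3≢1 : ¬ r ^ 3 ≡ 1#
      r^3≢1 r³≡1 = r^1≢1 (sym (trans (sym r^4≡1) (cong (r *_) r³≡1)))

      r^[k*4]≡1 : ∀ k → r ^ (k ℕ.* 4) ≡ 1#
      r^[k*4]≡1 zero    = refl
      r^[k*4]≡1 (suc k) = trans (^-homo-* r 4 (k ℕ.* 4)) (trans (cong₂ _*_ r^4≡1 (r^[k*4]≡1 k)) (*-identityˡ 1#))

      r^d≡1⇔4∣d : ∀ d → r ^ d ≡ 1# ⇔ 4 ∣ d
      r^d≡1⇔4∣d d = mk⇔ to from
        where
        from : 4 ∣ d → r ^ d ≡ 1#
        from (divides k refl) = r^[k*4]≡1 k

        below-4 : ∀ m → m < 4 → r ^ m ≡ 1# → m ≡ 0
        below-4 0 _ _ = refl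
        below-4 1 _ r^1≡1 = contradiction r^1≡1 r^1≢1
        below-4 2 _ r^2≡1 = contradiction r^2≡1 r^2≢1
        below-4 3 _ r^3≡1 = contradiction r^3≡1 r^3≢1
        below-4 (suc (suc (suc (suc _)))) (s≤s (s≤s (s≤s (s≤s ()))))

        to : r ^ d ≡ 1# → 4 ∣ d
        to r^d≡1 = m%n≡0⇒n∣m d 4 (below-4 (d % 4) (m%n<n d 4) (begin
          r ^ (d % 4)                                  ≡⟨ sym (*-identityʳ _) ⟩
          r ^ (d % 4) * 1#                             ≡⟨ cong (r ^ (d % 4) *_) (sym (r^[k*4]≡1 (d / 4))) ⟩
          r ^ (d % 4) * r ^ ((d / 4) ℕ.* 4)            ≡⟨ sym (^-homo-* r (d % 4) _) ⟩
          r ^ (d % 4 ℕ.+ (d / 4) ℕ.* 4)                ≡⟨ cong (r ^_) (sym (m≡m%n+[m/n]*n d 4)) ⟩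
          r ^ d                                        ≡⟨ r^d≡1 ⟩
          1#                                           ∎))
          where open ≡-Reasoning

      iter-Q-eigen : ∀ {x y} → κ (x , y) ≡ 0# → ∀ n → iter (Q (r + r)) n (x , y) ≡ (r ^ n * x , r ^ n * y)
      iter-Q-eigen {x} {y} κ≡0 n = trans (iter-Q n x y) (cong₂ _,_
        (≡-modulo κ≡0 (solve 5 (λ r x c P κ →
          P :* (x :+ c :* (r :* r :* r :* κ)) :+ κ :* con 0 := P :* x :+ κ :* (P :* c :* (r :* r :* r)))
          refl r x (n ·1) (r ^ n) (κ (x , y))))
        (≡-modulo κ≡0 (solve 5 (λ r y c P κ →
          P :* (y :+ c :* (r :* r :* κ)) :+ κ :* con 0 := P :* y :+ κ :* (P :* c :* (r :* r)))
          refl r y (n ·1) (r ^ n) (κ (x , y)))))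

      fixed⇔-eigen : ∀ {x y d} → κ (x , y) ≡ 0# → ¬ (x , y) ≡ zeroV →
                     iter (Q (r + r)) d (x , y) ≡ (x , y) ⇔ r ^ d ≡ 1#
      fixed⇔-eigen {x} {y} {d} κ≡0 v≢0 = mk⇔
        (λ fixed → *-cancelʳ-≡1 x≢0 (cong proj₁ (trans (sym (iter-Q-eigen κ≡0 d)) fixed)))
        (λ r^d≡1 → trans (iter-Q-eigen κ≡0 d)
          (cong₂ _,_ (trans (cong (_* x) r^d≡1) (*-identityˡ x)) (trans (cong (_* y) r^d≡1) (*-identityˡ y))))
        where
        x≢0 : ¬ x ≡ 0#
        x≢0 refl = v≢0 (cong (0# ,_) (trans (sym (κ[0,y]≡y y)) κ≡0))

      fixed⇔-generic : ∀ {x y d} → ¬ κ (x , y) ≡ 0# →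
                       iter (Q (r + r)) d (x , y) ≡ (x , y) ⇔ (r ^ d ≡ 1# × d ·1 ≡ 0#)
      fixed⇔-generic {x} {y} {d} κ≢0 = mk⇔ to from
        where
        open ≡-Reasoning
        P = r ^ d
        c = d ·1
        t₁ = r * r * r * κ (x , y)
        t₂ = r * r * κ (x , y)

        to : iter (Q (r + r)) d (x , y) ≡ (x , y) → P ≡ 1# × c ≡ 0#
        to fixed = P≡1 , c≡0
          where
          fixed₁ : P * (x + c * t₁) ≡ x
          fixed₁ = cong proj₁ (trans (sym (iter-Q d x y)) fixed)
          fixed₂ : P * (y + c * t₂) ≡ y
          fixed₂ = cong proj₂ (trans (sym (iter-Q d x y)) fixed)
          -- κ (Qᵈ v) = rᵈ κ v.
          P≡1 : P ≡ 1#
          P≡1 = *-cancelʳ-≡1 κ≢0 (begin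
            P * κ (x , y)
              ≡⟨ ≡-modulo r²+1≡0 (solve 6 (λ r x y c P κ →
                   P :* (r :* x :+ y) :+ (r :* r :+ con 1) :* (P :* c :* r :* r :* κ)
                := r :* (P :* (x :+ c :* (r :* r :* r :* κ))) :+ P :* (y :+ c :* (r :* r :* κ))
                   :+ (r :* r :+ con 1) :* con 0)
                 refl r x y c P (κ (x , y))) ⟩
            r * (P * (x + c * t₁)) + P * (y + c * t₂)   ≡⟨ cong₂ (λ u w → r * u + w) fixed₁ fixed₂ ⟩
            κ (x , y)                                   ∎)
          ct₂≡0 : c * t₂ ≡ 0#
          ct₂≡0 = +-cancelˡ-≡0 (trans (sym (*-identityˡ _)) (trans (cong (λ u → u * (y + c * t₂)) (sym P≡1)) fixed₂))
          t₂≢0 : ¬ t₂ ≡ 0#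
          t₂≢0 t₂≡0 = κ≢0 (zero-product t₂≡0 r*r≢0)
          c≡0 : c ≡ 0#
          c≡0 = zero-product (trans (*-comm t₂ c) ct₂≡0) t₂≢0

        from : P ≡ 1# × c ≡ 0# → iter (Q (r + r)) d (x , y) ≡ (x , y)
        from (P≡1 , c≡0) = begin
          iter (Q (r + r)) d (x , y)                     ≡⟨ iter-Q d x y ⟩
          (P * (x + c * t₁) , P * (y + c * t₂))          ≡⟨ cong₂ (λ P c → P * (x + c * t₁) , P * (y + c * t₂)) P≡1 c≡0 ⟩
          (1# * (x + 0# * t₁) , 1# * (y + 0# * t₂))      ≡⟨ cong₂ _,_ (unchanged x t₁) (unchanged y t₂) ⟩
          (x , y)                                        ∎
          where
          unchanged : ∀ u t → 1# * (u + 0# * t) ≡ u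
          unchanged u t = solve 2 (λ u t → con 1 :* (u :+ con 0 :* t) := u) refl u t

      4·1≢0 : ¬ 4 ·1 ≡ 0#
      4·1≢0 4·1≡0 = odd⇒2·1≢0 p-odd (zero-product (trans (sym (·1-homo-* 2 2)) 4·1≡0) (odd⇒2·1≢0 p-odd))

      period-eigen : ∀ {v} → κ v ≡ 0# → ¬ v ≡ zeroV → ∀ d → iter (Q (r + r)) d v ≡ v ⇔ 4 ∣ d
      period-eigen κ≡0 v≢0 d = ⇔-trans (fixed⇔-eigen κ≡0 v≢0) (r^d≡1⇔4∣d d)

      period-generic : ∀ {v} → ¬ κ v ≡ 0# → ∀ d → iter (Q (r + r)) d v ≡ v ⇔ 4 ℕ.* p ∣ d
      period-generic κ≢0 d = ⇔-trans (fixed⇔-generic κ≢0) (mk⇔ to from)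
        where
        to : r ^ d ≡ 1# × d ·1 ≡ 0# → 4 ℕ.* p ∣ d
        to (r^d≡1 , d·1≡0) with Equivalence.to (r^d≡1⇔4∣d d) r^d≡1
        ... | divides k refl = subst (4 ℕ.* p ∣_) (ℕ.*-comm 4 k) (*-monoʳ-∣ 4 (·1≡0⇒∣ {k} k·1≡0))
          where
          k·1≡0 : k ·1 ≡ 0#
          k·1≡0 = zero-product (trans (*-comm (4 ·1) (k ·1)) (trans (sym (·1-homo-* k 4)) d·1≡0)) 4·1≢0

        from : 4 ℕ.* p ∣ d → r ^ d ≡ 1# × d ·1 ≡ 0#
        from 4p∣d = Equivalence.from (r^d≡1⇔4∣d d) (∣-trans (m∣m*n p) 4p∣d) , ∣⇒·1≡0 (∣-trans (n∣m*n 4) 4p∣d)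

      orbitLength-eigen : ∀ {v} → κ v ≡ 0# → ¬ v ≡ zeroV → OrbitLength (r + r) v 4
      orbitLength-eigen κ≡0 v≢0 = orbitLength 4 (period-eigen κ≡0 v≢0)

      orbitLength-generic : ∀ {v} → ¬ κ v ≡ 0# → OrbitLength (r + r) v (4 ℕ.* p)
      orbitLength-generic κ≢0 = orbitLength (4 ℕ.* p) {{ℕ.m*n≢0 4 p}} (period-generic κ≢0)

      nonzero-orbitLength : ∀ v → ¬ v ≡ zeroV → OrbitLength (r + r) v 4 ⊎ OrbitLength (r + r) v (4 ℕ.* p)
      nonzero-orbitLength v v≢0 with κ v ≟ 0#
      ... | yes κ≡0 = inj₁ (orbitLength-eigen κ≡0 v≢0)
      ... | no  κ≢0 = inj₂ (orbitLength-generic κ≢0)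

      eigenvector : V
      eigenvector = 1# , r * r * r

      eigenvector≢0 : ¬ eigenvector ≡ zeroV
      eigenvector≢0 v≡0 = 0≢1 (sym (cong proj₁ v≡0))

      κ[eigenvector]≡0 : κ eigenvector ≡ 0#
      κ[eigenvector]≡0 = ≡-modulo r²+1≡0 (solve 1 (λ r →
        r :* con 1 :+ r :* r :* r :+ (r :* r :+ con 1) :* con 0 := con 0 :+ (r :* r :+ con 1) :* r) refl r)

      e₂ : V
      e₂ = 0# , 1#

      e₂≢0 : ¬ e₂ ≡ zeroV
      e₂≢0 v≡0 = 0≢1 (sym (cong proj₂ v≡0))

      κ[e₂]≢0 : ¬ κ e₂ ≡ 0#
      κ[e₂]≢0 κ≡0 = 0≢1 (sym (trans (sym (κ[0,y]≡y 1#)) κ≡0))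

      q≡1[mod4] : q % 4 ≡ 1
      q≡1[mod4] = subst (λ n → n % 4 ≡ 1) 1+k*4≡q ([m+kn]%n≡m%n 1 k 4)
        where
        open ListDifference _≟_

        nonzeros : List Carrier
        nonzeros = elements ∖ (0# ∷ [])

        nonzero : ∀ {z} → z ∈ nonzeros → ¬ z ≡ 0#
        nonzero z∈ z≡0 = proj₂ (∈-∖⁻ elements (0# ∷ []) z∈) (here z≡0)

        r⁴z≡z : ∀ z → r * (r * (r * (r * z))) ≡ z
        r⁴z≡z z = ≡-modulo r²+1≡0 (solve 2 (λ r z →
          r :* (r :* (r :* (r :* z))) :+ (r :* r :+ con 1) :* z := z :+ (r :* r :+ con 1) :* (r :* r :* z)) refl r z)

        closed : ∀ {z} → z ∈ nonzeros → r * z ∈ nonzeros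
        closed z∈ = ∈-∖⁺ elements (0# ∷ []) (∈-elements _) λ { (here rz≡0) → nonzero z∈ (zero-product rz≡0 r≢0) ; (there ()) }

        4∣nonzeros : 4 ∣ length nonzeros
        4∣nonzeros = 4∣length (r *_) r⁴z≡z nonzeros (∖-unique (0# ∷ []) elements-unique) closed (r²z≢z ∘ nonzero)

        k : ℕ
        k = _∣_.quotient 4∣nonzeros

        1+k*4≡q : 1 ℕ.+ k ℕ.* 4 ≡ q
        1+k*4≡q = begin
          1 ℕ.+ k ℕ.* 4              ≡⟨ cong suc (sym (_∣_.equality 4∣nonzeros)) ⟩
          1 ℕ.+ length nonzeros      ≡⟨ length-∖ elements-unique ([] ∷ []) (∈-elements 0# ∷ []) ⟩
          length elements            ≡⟨ length-elements ⟩
          q                          ∎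
          where open ≡-Reasoning

open import Data.Nat using (ℕ; _*_; _%_)
open import Data.Product using (_×_; ∃-syntax)
open import Data.Sum using (_⊎_)
open import Relation.Binary.PropositionalEquality using (_≡_)
open import Relation.Nullary using (¬_)
open FiniteField using (Carrier; HasCharacteristic; HasRepeatedRoot; zeroV; OrbitLength)

mainTheorem15 : (q p : ℕ) (F : FiniteField q) →
    HasCharacteristic F p → p % 2 ≡ 1 → (a : Carrier F) → HasRepeatedRoot F a →
    (q % 4 ≡ 1)
    × (∀ v → ¬ (v ≡ zeroV F) → OrbitLength F a v 4 ⊎ OrbitLength F a v (4 * p))
    × (∃[ v ] (¬ (v ≡ zeroV F) × OrbitLength F a v 4))
    × (∃[ v ] (¬ (v ≡ zeroV F) × OrbitLength F a v (4 * p)))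
mainTheorem15 q p F char p-odd a (r , refl , r²≡-1) =
    q≡1[mod4]
  , nonzero-orbitLength
  , (eigenvector , eigenvector≢0 , orbitLength-eigen κ[eigenvector]≡0 eigenvector≢0)
  , (e₂ , e₂≢0 , orbitLength-generic κ[e₂]≢0)
  where open RepeatedRoot F char p-odd r r²≡-1
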